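{- There exist $4$-GDDs of types $2^{17} 5^8$ and $2^7 5^{12}$.
   Context: A $4$-GDD is a triple $(X,\mathcal{G},\mathcal{B})$ where $X$ is a finite point set, $\mathcal{G}$ a partition of $X$ into groups, and $\mathcal{B}$ a collection of $4$-element subsets (blocks) such that no block meets a group in more than one point and any two points from distinct groups lie in exactly one common block. Type $2^t5^s$ means $t$ groups of size $2$ and $s$ groups of size $5$. -}

module Defs where

open import Data.Nat using (ℕ; _<ᵇ_; _+_)
open import Data.Bool using (if_then_else_)
open import Data.Fin using (Fin; toℕ; _≟_)
open import Data.List using (List; length; filter; lookup; allFin)
open import Data.List.Membership.Propositional using () renaming (_∈_ to _∈ₗ_)
open import Data.Vec using (Vec)
import Data.Vec as V
open import Data.Vec.Membership.Propositional using (_∈_)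
open import Data.Product using (Σ; _×_)
open import Relation.Binary.PropositionalEquality using (_≡_; _≢_)

classSize : {n m : ℕ} → (Fin n → Fin m) → Fin m → ℕ
classSize {n} g j = length (filter (λ x → g x ≟ j) (allFin n))

typeSize : (t s : ℕ) → Fin (t + s) → ℕ
typeSize t s j = if toℕ j <ᵇ t then 2 else 5

-- Groups: the fibres of the labelling  grp : Fin n → Fin (t+s)
-- (a partition of the point set into t+s groups, group j having
-- typeSize t s j points).
record GDD4 (t s : ℕ) : Set where
  field
    n      : ℕ
    grp    : Fin n → Fin (t + s)
    grpSize : (j : Fin (t + s)) → classSize grp j ≡ typeSize t s j
    blocks : List (Vec (Fin n) 4)
    -- no block meets a group in more than one point (in particular the
    -- four entries of a block are distinct, so blocks are 4-element sets)
    transversal : (b : Vec (Fin n) 4) → b ∈ₗ blocks →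
                  (i j : Fin 4) → i ≢ j → grp (V.lookup b i) ≢ grp (V.lookup b j)
    covered : (x y : Fin n) → grp x ≢ grp y →
              Σ (Fin (length blocks)) λ k →
                (x ∈ lookup blocks k × y ∈ lookup blocks k) ×
                ((k′ : Fin (length blocks)) →
                  x ∈ lookup blocks k′ → y ∈ lookup blocks k′ → k′ ≡ k)

-- Both designs live on 74 = 2·17 + 5·8 = 2·7 + 5·12 points and are given by explicit
-- lists of blocks (434 and 429 of them: each block covers 6 of the cross-group pairs).
-- Verifying the GDD axioms is then a finite computation; uniqueness of the block through
-- a cross-group pair comes from the list of blocks through it having length 1.
module Submission where

open import Data.Bool using (Bool; false; T; _∧_; _∨_)
open import Data.Bool.ListAction using (all)
open import Data.Bool.Properties using (T-∧; T-∨)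
open import Data.Fin using (Fin; zero; suc; toℕ; _↑ˡ_; _↑ʳ_; splitAt; quotient)
import Data.Fin.Literals
open import Data.Fin.Properties using (_≟_; all?; toℕ-injective)
open import Data.List using (List; []; _∷_; length; lookup; filter; filterᵇ; map; allFin)
open import Data.List.Membership.Propositional using (lose)
open import Data.List.Membership.Propositional.Properties using (∈-lookup; ∈-allFin)
open import Data.List.Properties using (filter-some)
open import Data.List.Relation.Unary.All as All using ()
open import Data.List.Relation.Unary.All.Properties using (all⁺)
open import Data.Nat using (ℕ; _+_; _*_; _<_; _≡ᵇ_)
open import Data.Nat.Properties using (≡ᵇ⇒≡; ≡⇒≡ᵇ; suc-injective) renaming (_≟_ to _≟ℕ_)
open import Data.Product using (Σ; _×_; _,_)
open import Data.Product.Function.NonDependent.Propositional using (_×-⇔_)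
open import Data.Sum using (inj₁; inj₂; [_,_]′)
open import Data.Vec using (Vec; _∷_; [])
import Data.Vec as Vec
open import Data.Vec.Membership.Propositional using (_∈_)
import Data.Vec.Relation.Unary.Any as Any
open import Data.Vec.Relation.Unary.Any.Properties using (map⁺; map⁻)
open import Function using (_∘_; _⇔_; mk⇔; Equivalence)
open import Function.Construct.Composition using (_⇔-∘_)
open import Relation.Binary.PropositionalEquality using (_≡_; _≢_; refl; cong; subst; module ≡-Reasoning)
open import Relation.Nullary using (yes; no; ¬?; contradiction; _→-dec_)
open import Relation.Nullary.Decidable using (True; T?; isYes; toWitness)
open import Relation.Unary using (Pred; Decidable)

open import Defs
open ≡-Reasoning

module _ {a b p} {A : Set a} {B : Set b} {P : Pred B p} (P? : Decidable P) (f : A → B) where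

  length-filter-map : ∀ xs → length (filter P? (map f xs)) ≡ length (filter (P? ∘ f) xs)
  length-filter-map []       = refl
  length-filter-map (x ∷ xs) with P? (f x)
  ... | yes _ = cong ℕ.suc (length-filter-map xs)
  ... | no  _ = length-filter-map xs

module _ {a p} {A : Set a} {P : Pred A p} (P? : Decidable P) where

  filter-length≡1⇒unique : ∀ xs → length (filter P? xs) ≡ 1 →
    Σ (Fin (length xs)) λ k → P (lookup xs k) × (∀ k′ → P (lookup xs k′) → k′ ≡ k)
  filter-length≡1⇒unique (x ∷ xs) eq with P? x
  ... | yes px = zero , px , onlyZero
    where
    onlyZero : ∀ k′ → P (lookup (x ∷ xs) k′) → k′ ≡ zero
    onlyZero zero     _   = refl
    onlyZero (suc k′) pk′ = contradiction
      (subst (0 <_) (suc-injective eq) (filter-some P? (lose (∈-lookup {xs = xs} k′) pk′)))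
      λ ()
  ... | no ¬px with k , pk , unique ← filter-length≡1⇒unique xs eq = suc k , pk , unique′
    where
    unique′ : ∀ k′ → P (lookup (x ∷ xs) k′) → k′ ≡ suc k
    unique′ zero     pk′ = contradiction pk′ ¬px
    unique′ (suc k′) pk′ = cong suc (unique k′ pk′)

_∈ᵇ_ : ∀ {n} → ℕ → Vec ℕ n → Bool
i ∈ᵇ []       = false
i ∈ᵇ (j ∷ js) = (i ≡ᵇ j) ∨ (i ∈ᵇ js)

T-∈ᵇ : ∀ {n i} {js : Vec ℕ n} → T (i ∈ᵇ js) ⇔ i ∈ js
T-∈ᵇ {js = []}             = mk⇔ (λ ()) (λ ())
T-∈ᵇ {i = i} {js = j ∷ js} = mk⇔ to from
  where
  to : T (i ∈ᵇ (j ∷ js)) → i ∈ j ∷ js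
  to h with Equivalence.to T-∨ h
  ... | inj₁ i≡j  = Any.here (≡ᵇ⇒≡ i j i≡j)
  ... | inj₂ i∈js = Any.there (Equivalence.to T-∈ᵇ i∈js)

  from : i ∈ j ∷ js → T (i ∈ᵇ (j ∷ js))
  from (Any.here refl)   = Equivalence.from T-∨ (inj₁ (≡⇒≡ᵇ i i refl))
  from (Any.there i∈js) = Equivalence.from T-∨ (inj₂ (Equivalence.from T-∈ᵇ i∈js))

toℕ-∈⇔ : ∀ {m n} {x : Fin m} {xs : Vec (Fin m) n} → toℕ x ∈ Vec.map toℕ xs ⇔ x ∈ xs
toℕ-∈⇔ = mk⇔ (Any.map toℕ-injective ∘ map⁻) (map⁺ ∘ Any.map (cong toℕ))

passesThroughᵇ : ∀ {n} → ℕ → ℕ → Vec ℕ n → Bool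
passesThroughᵇ i j r = (i ∈ᵇ r) ∧ (j ∈ᵇ r)

T-passesThroughᵇ : ∀ {m n} {x y : Fin m} {b : Vec (Fin m) n} →
  T (passesThroughᵇ (toℕ x) (toℕ y) (Vec.map toℕ b)) ⇔ (x ∈ b × y ∈ b)
T-passesThroughᵇ = ((toℕ-∈⇔ ⇔-∘ T-∈ᵇ) ×-⇔ (toℕ-∈⇔ ⇔-∘ T-∈ᵇ)) ⇔-∘ T-∧

Point : ℕ → ℕ → Set
Point t s = Fin (t * 2 + s * 5)

Block : ℕ → ℕ → Set
Block t s = Vec (Point t s) 4

-- Points 0 … 2t−1 form the t groups of size 2 as consecutive pairs, the remaining
-- points form the s groups of size 5 as consecutive runs of five.
groupOf : ∀ t s → Point t s → Fin (t + s)
groupOf t s p = [ (λ i → quotient 2 i ↑ˡ s) , (λ i → t ↑ʳ quotient 5 i) ]′ (splitAt (t * 2) p)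

module _ (t s : ℕ) where

  private
    grp : Point t s → Fin (t + s)
    grp = groupOf t s

  Transversal : Block t s → Set
  Transversal b = ∀ i j → i ≢ j → grp (Vec.lookup b i) ≢ grp (Vec.lookup b j)

  transversal? : Decidable Transversal
  transversal? b = all? λ i → all? λ j →
    ¬? (i ≟ j) →-dec ¬? (grp (Vec.lookup b i) ≟ grp (Vec.lookup b j))

  -- The pair test compares the ℕ labels of the block entries, computed once by
  -- `labels blocks`, so that its many membership tests run on builtin naturals.
  labels : List (Block t s) → List (Vec ℕ 4)
  labels = map (Vec.map toℕ)

  coveredOnceᵇ : List (Vec ℕ 4) → Point t s → Point t s → Bool
  coveredOnceᵇ ls x y =
    isYes (grp x ≟ grp y) ∨ (length (filterᵇ (passesThroughᵇ (toℕ x) (toℕ y)) ls) ≡ᵇ 1)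

  everyPairCoveredOnceᵇ : List (Vec ℕ 4) → Bool
  everyPairCoveredOnceᵇ ls = all (λ x → all (coveredOnceᵇ ls x) (allFin _)) (allFin _)

  T-everyPairCoveredOnceᵇ : ∀ ls → T (everyPairCoveredOnceᵇ ls) →
    ∀ x y → T (coveredOnceᵇ ls x y)
  T-everyPairCoveredOnceᵇ ls h x y =
    All.lookup (all⁺ _ _ (All.lookup (all⁺ _ _ h) (∈-allFin x))) (∈-allFin y)

  coveredOnce⇒uniqueBlock : ∀ blocks x y → T (coveredOnceᵇ (labels blocks) x y) →
    grp x ≢ grp y →
    Σ (Fin (length blocks)) λ k → (x ∈ lookup blocks k × y ∈ lookup blocks k) ×
      (∀ k′ → x ∈ lookup blocks k′ → y ∈ lookup blocks k′ → k′ ≡ k)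
  coveredOnce⇒uniqueBlock blocks x y h x≁y with Equivalence.to (T-∨ {isYes (grp x ≟ grp y)}) h
  ... | inj₁ same = contradiction (toWitness {a? = grp x ≟ grp y} same) x≁y
  ... | inj₂ once =
    let k , x,y∈k , unique = filter-length≡1⇒unique (T? ∘ through) blocks count≡1
    in  k , Equivalence.to T-passesThroughᵇ x,y∈k ,
        λ k′ x∈k′ y∈k′ → unique k′ (Equivalence.from T-passesThroughᵇ (x∈k′ , y∈k′))
    where
    through : Block t s → Bool
    through = passesThroughᵇ (toℕ x) (toℕ y) ∘ Vec.map toℕ

    count≡1 : length (filter (T? ∘ through) blocks) ≡ 1
    count≡1 = begin
      length (filter (T? ∘ through) blocks)
        ≡⟨ length-filter-map (T? ∘ passesThroughᵇ (toℕ x) (toℕ y)) (Vec.map toℕ) blocks ⟨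
      length (filterᵇ (passesThroughᵇ (toℕ x) (toℕ y)) (labels blocks))
        ≡⟨ ≡ᵇ⇒≡ _ 1 once ⟩
      1 ∎

  mkGDD4 : (blocks : List (Block t s)) →
           {True (all? λ j → classSize grp j ≟ℕ typeSize t s j)} →
           {True (All.all? transversal? blocks)} →
           {T (everyPairCoveredOnceᵇ (labels blocks))} →
           GDD4 t s
  mkGDD4 blocks {sizes} {transversal} {covered} = record
    { n           = t * 2 + s * 5
    ; grp         = grp
    ; grpSize     = toWitness sizes
    ; blocks      = blocks
    ; transversal = λ b b∈blocks → All.lookup (toWitness transversal) b∈blocks
    ; covered     = λ x y → coveredOnce⇒uniqueBlock blocks x y
                              (T-everyPairCoveredOnceᵇ (labels blocks) covered x y)
    }

module _ where

  open import Agda.Builtin.FromNat using (Number; fromNat)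
  import Data.Nat.Literals
  -- tt is the instance discharging the ⊤-valued side conditions of the literals.
  open import Data.Unit using (tt)

  instance
    natLiterals : Number ℕ
    natLiterals = Data.Nat.Literals.number

    finLiterals : ∀ {n} → Number (Fin n)
    finLiterals {n} = Data.Fin.Literals.number n

  blocks-2¹⁷5⁸ : List (Block 17 8)
  blocks-2¹⁷5⁸ =
      (0 ∷ 2 ∷ 25 ∷ 27 ∷ []) ∷ (0 ∷ 3 ∷ 39 ∷ 69 ∷ []) ∷ (0 ∷ 4 ∷ 20 ∷ 56 ∷ []) ∷ (0 ∷ 5 ∷ 66 ∷ 71 ∷ [])
    ∷ (0 ∷ 6 ∷ 17 ∷ 21 ∷ []) ∷ (0 ∷ 7 ∷ 30 ∷ 32 ∷ []) ∷ (0 ∷ 8 ∷ 45 ∷ 52 ∷ []) ∷ (0 ∷ 9 ∷ 61 ∷ 73 ∷ [])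
    ∷ (0 ∷ 10 ∷ 38 ∷ 63 ∷ []) ∷ (0 ∷ 11 ∷ 37 ∷ 68 ∷ []) ∷ (0 ∷ 12 ∷ 50 ∷ 60 ∷ []) ∷ (0 ∷ 13 ∷ 18 ∷ 46 ∷ [])
    ∷ (0 ∷ 14 ∷ 28 ∷ 34 ∷ []) ∷ (0 ∷ 15 ∷ 26 ∷ 31 ∷ []) ∷ (0 ∷ 16 ∷ 29 ∷ 59 ∷ []) ∷ (0 ∷ 19 ∷ 53 ∷ 65 ∷ [])
    ∷ (0 ∷ 22 ∷ 43 ∷ 57 ∷ []) ∷ (0 ∷ 23 ∷ 67 ∷ 72 ∷ []) ∷ (0 ∷ 24 ∷ 35 ∷ 41 ∷ []) ∷ (0 ∷ 33 ∷ 40 ∷ 48 ∷ [])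
    ∷ (0 ∷ 36 ∷ 44 ∷ 62 ∷ []) ∷ (0 ∷ 42 ∷ 51 ∷ 54 ∷ []) ∷ (0 ∷ 47 ∷ 55 ∷ 64 ∷ []) ∷ (0 ∷ 49 ∷ 58 ∷ 70 ∷ [])
    ∷ (1 ∷ 2 ∷ 34 ∷ 44 ∷ []) ∷ (1 ∷ 3 ∷ 24 ∷ 26 ∷ []) ∷ (1 ∷ 4 ∷ 36 ∷ 60 ∷ []) ∷ (1 ∷ 5 ∷ 21 ∷ 50 ∷ [])
    ∷ (1 ∷ 6 ∷ 31 ∷ 32 ∷ []) ∷ (1 ∷ 7 ∷ 16 ∷ 20 ∷ []) ∷ (1 ∷ 8 ∷ 38 ∷ 65 ∷ []) ∷ (1 ∷ 9 ∷ 41 ∷ 58 ∷ [])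
    ∷ (1 ∷ 10 ∷ 62 ∷ 72 ∷ []) ∷ (1 ∷ 11 ∷ 67 ∷ 73 ∷ []) ∷ (1 ∷ 12 ∷ 19 ∷ 40 ∷ []) ∷ (1 ∷ 13 ∷ 56 ∷ 66 ∷ [])
    ∷ (1 ∷ 14 ∷ 27 ∷ 30 ∷ []) ∷ (1 ∷ 15 ∷ 29 ∷ 69 ∷ []) ∷ (1 ∷ 17 ∷ 28 ∷ 64 ∷ []) ∷ (1 ∷ 18 ∷ 57 ∷ 61 ∷ [])
    ∷ (1 ∷ 22 ∷ 37 ∷ 63 ∷ []) ∷ (1 ∷ 23 ∷ 47 ∷ 53 ∷ []) ∷ (1 ∷ 25 ∷ 45 ∷ 70 ∷ []) ∷ (1 ∷ 33 ∷ 42 ∷ 46 ∷ [])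
    ∷ (1 ∷ 35 ∷ 52 ∷ 54 ∷ []) ∷ (1 ∷ 39 ∷ 68 ∷ 71 ∷ []) ∷ (1 ∷ 43 ∷ 51 ∷ 59 ∷ []) ∷ (1 ∷ 48 ∷ 49 ∷ 55 ∷ [])
    ∷ (2 ∷ 4 ∷ 24 ∷ 28 ∷ []) ∷ (2 ∷ 5 ∷ 31 ∷ 39 ∷ []) ∷ (2 ∷ 6 ∷ 16 ∷ 70 ∷ []) ∷ (2 ∷ 7 ∷ 51 ∷ 61 ∷ [])
    ∷ (2 ∷ 8 ∷ 42 ∷ 57 ∷ []) ∷ (2 ∷ 9 ∷ 43 ∷ 52 ∷ []) ∷ (2 ∷ 10 ∷ 47 ∷ 50 ∷ []) ∷ (2 ∷ 11 ∷ 63 ∷ 71 ∷ [])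
    ∷ (2 ∷ 12 ∷ 29 ∷ 32 ∷ []) ∷ (2 ∷ 13 ∷ 19 ∷ 22 ∷ []) ∷ (2 ∷ 14 ∷ 45 ∷ 55 ∷ []) ∷ (2 ∷ 15 ∷ 23 ∷ 65 ∷ [])
    ∷ (2 ∷ 17 ∷ 56 ∷ 62 ∷ []) ∷ (2 ∷ 18 ∷ 30 ∷ 49 ∷ []) ∷ (2 ∷ 20 ∷ 48 ∷ 58 ∷ []) ∷ (2 ∷ 21 ∷ 38 ∷ 68 ∷ [])
    ∷ (2 ∷ 26 ∷ 36 ∷ 40 ∷ []) ∷ (2 ∷ 33 ∷ 35 ∷ 72 ∷ []) ∷ (2 ∷ 37 ∷ 60 ∷ 64 ∷ []) ∷ (2 ∷ 41 ∷ 53 ∷ 69 ∷ [])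
    ∷ (2 ∷ 46 ∷ 59 ∷ 67 ∷ []) ∷ (2 ∷ 54 ∷ 66 ∷ 73 ∷ []) ∷ (3 ∷ 4 ∷ 30 ∷ 44 ∷ []) ∷ (3 ∷ 5 ∷ 25 ∷ 29 ∷ [])
    ∷ (3 ∷ 6 ∷ 55 ∷ 65 ∷ []) ∷ (3 ∷ 7 ∷ 17 ∷ 35 ∷ []) ∷ (3 ∷ 8 ∷ 47 ∷ 58 ∷ []) ∷ (3 ∷ 9 ∷ 48 ∷ 53 ∷ [])
    ∷ (3 ∷ 10 ∷ 36 ∷ 67 ∷ []) ∷ (3 ∷ 11 ∷ 43 ∷ 56 ∷ []) ∷ (3 ∷ 12 ∷ 18 ∷ 23 ∷ []) ∷ (3 ∷ 13 ∷ 28 ∷ 32 ∷ [])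
    ∷ (3 ∷ 14 ∷ 22 ∷ 61 ∷ []) ∷ (3 ∷ 15 ∷ 41 ∷ 51 ∷ []) ∷ (3 ∷ 16 ∷ 50 ∷ 68 ∷ []) ∷ (3 ∷ 19 ∷ 31 ∷ 54 ∷ [])
    ∷ (3 ∷ 20 ∷ 62 ∷ 73 ∷ []) ∷ (3 ∷ 21 ∷ 42 ∷ 52 ∷ []) ∷ (3 ∷ 27 ∷ 46 ∷ 71 ∷ []) ∷ (3 ∷ 33 ∷ 37 ∷ 70 ∷ [])
    ∷ (3 ∷ 34 ∷ 45 ∷ 57 ∷ []) ∷ (3 ∷ 38 ∷ 49 ∷ 60 ∷ []) ∷ (3 ∷ 40 ∷ 63 ∷ 64 ∷ []) ∷ (3 ∷ 59 ∷ 66 ∷ 72 ∷ [])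
    ∷ (4 ∷ 6 ∷ 27 ∷ 29 ∷ []) ∷ (4 ∷ 7 ∷ 39 ∷ 49 ∷ []) ∷ (4 ∷ 8 ∷ 22 ∷ 66 ∷ []) ∷ (4 ∷ 9 ∷ 40 ∷ 71 ∷ [])
    ∷ (4 ∷ 10 ∷ 19 ∷ 23 ∷ []) ∷ (4 ∷ 11 ∷ 25 ∷ 32 ∷ []) ∷ (4 ∷ 12 ∷ 55 ∷ 62 ∷ []) ∷ (4 ∷ 13 ∷ 35 ∷ 42 ∷ [])
    ∷ (4 ∷ 14 ∷ 37 ∷ 48 ∷ []) ∷ (4 ∷ 15 ∷ 47 ∷ 73 ∷ []) ∷ (4 ∷ 16 ∷ 43 ∷ 72 ∷ []) ∷ (4 ∷ 17 ∷ 53 ∷ 67 ∷ [])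
    ∷ (4 ∷ 18 ∷ 31 ∷ 34 ∷ []) ∷ (4 ∷ 21 ∷ 63 ∷ 70 ∷ []) ∷ (4 ∷ 26 ∷ 45 ∷ 51 ∷ []) ∷ (4 ∷ 33 ∷ 50 ∷ 58 ∷ [])
    ∷ (4 ∷ 38 ∷ 46 ∷ 54 ∷ []) ∷ (4 ∷ 41 ∷ 59 ∷ 68 ∷ []) ∷ (4 ∷ 52 ∷ 61 ∷ 64 ∷ []) ∷ (4 ∷ 57 ∷ 65 ∷ 69 ∷ [])
    ∷ (5 ∷ 6 ∷ 44 ∷ 54 ∷ []) ∷ (5 ∷ 7 ∷ 26 ∷ 28 ∷ []) ∷ (5 ∷ 8 ∷ 36 ∷ 46 ∷ []) ∷ (5 ∷ 9 ∷ 23 ∷ 60 ∷ [])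
    ∷ (5 ∷ 10 ∷ 24 ∷ 32 ∷ []) ∷ (5 ∷ 11 ∷ 18 ∷ 22 ∷ []) ∷ (5 ∷ 12 ∷ 48 ∷ 70 ∷ []) ∷ (5 ∷ 13 ∷ 51 ∷ 68 ∷ [])
    ∷ (5 ∷ 14 ∷ 38 ∷ 43 ∷ []) ∷ (5 ∷ 15 ∷ 42 ∷ 72 ∷ []) ∷ (5 ∷ 16 ∷ 57 ∷ 63 ∷ []) ∷ (5 ∷ 17 ∷ 37 ∷ 47 ∷ [])
    ∷ (5 ∷ 19 ∷ 30 ∷ 69 ∷ []) ∷ (5 ∷ 20 ∷ 35 ∷ 67 ∷ []) ∷ (5 ∷ 27 ∷ 41 ∷ 55 ∷ []) ∷ (5 ∷ 33 ∷ 52 ∷ 56 ∷ [])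
    ∷ (5 ∷ 34 ∷ 53 ∷ 61 ∷ []) ∷ (5 ∷ 40 ∷ 49 ∷ 73 ∷ []) ∷ (5 ∷ 45 ∷ 62 ∷ 64 ∷ []) ∷ (5 ∷ 58 ∷ 59 ∷ 65 ∷ [])
    ∷ (6 ∷ 8 ∷ 26 ∷ 30 ∷ []) ∷ (6 ∷ 9 ∷ 24 ∷ 49 ∷ []) ∷ (6 ∷ 10 ∷ 18 ∷ 41 ∷ []) ∷ (6 ∷ 11 ∷ 35 ∷ 61 ∷ [])
    ∷ (6 ∷ 12 ∷ 52 ∷ 67 ∷ []) ∷ (6 ∷ 13 ∷ 53 ∷ 62 ∷ []) ∷ (6 ∷ 14 ∷ 57 ∷ 60 ∷ []) ∷ (6 ∷ 15 ∷ 37 ∷ 40 ∷ [])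
    ∷ (6 ∷ 19 ∷ 38 ∷ 66 ∷ []) ∷ (6 ∷ 20 ∷ 25 ∷ 59 ∷ []) ∷ (6 ∷ 22 ∷ 58 ∷ 68 ∷ []) ∷ (6 ∷ 23 ∷ 48 ∷ 73 ∷ [])
    ∷ (6 ∷ 28 ∷ 46 ∷ 50 ∷ []) ∷ (6 ∷ 33 ∷ 43 ∷ 45 ∷ []) ∷ (6 ∷ 34 ∷ 56 ∷ 72 ∷ []) ∷ (6 ∷ 36 ∷ 47 ∷ 69 ∷ [])
    ∷ (6 ∷ 39 ∷ 51 ∷ 63 ∷ []) ∷ (6 ∷ 42 ∷ 64 ∷ 71 ∷ []) ∷ (7 ∷ 8 ∷ 25 ∷ 54 ∷ []) ∷ (7 ∷ 9 ∷ 27 ∷ 31 ∷ [])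
    ∷ (7 ∷ 10 ∷ 65 ∷ 70 ∷ []) ∷ (7 ∷ 11 ∷ 19 ∷ 45 ∷ []) ∷ (7 ∷ 12 ∷ 57 ∷ 68 ∷ []) ∷ (7 ∷ 13 ∷ 58 ∷ 63 ∷ [])
    ∷ (7 ∷ 14 ∷ 46 ∷ 72 ∷ []) ∷ (7 ∷ 15 ∷ 53 ∷ 66 ∷ []) ∷ (7 ∷ 18 ∷ 60 ∷ 73 ∷ []) ∷ (7 ∷ 21 ∷ 24 ∷ 64 ∷ [])
    ∷ (7 ∷ 22 ∷ 38 ∷ 42 ∷ []) ∷ (7 ∷ 23 ∷ 52 ∷ 62 ∷ []) ∷ (7 ∷ 29 ∷ 40 ∷ 56 ∷ []) ∷ (7 ∷ 33 ∷ 41 ∷ 47 ∷ [])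
    ∷ (7 ∷ 34 ∷ 43 ∷ 71 ∷ []) ∷ (7 ∷ 36 ∷ 48 ∷ 59 ∷ []) ∷ (7 ∷ 37 ∷ 50 ∷ 69 ∷ []) ∷ (7 ∷ 44 ∷ 55 ∷ 67 ∷ [])
    ∷ (8 ∷ 10 ∷ 29 ∷ 31 ∷ []) ∷ (8 ∷ 11 ∷ 49 ∷ 59 ∷ []) ∷ (8 ∷ 12 ∷ 17 ∷ 71 ∷ []) ∷ (8 ∷ 13 ∷ 40 ∷ 50 ∷ [])
    ∷ (8 ∷ 14 ∷ 16 ∷ 21 ∷ []) ∷ (8 ∷ 15 ∷ 27 ∷ 32 ∷ []) ∷ (8 ∷ 18 ∷ 43 ∷ 53 ∷ []) ∷ (8 ∷ 19 ∷ 63 ∷ 72 ∷ [])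
    ∷ (8 ∷ 20 ∷ 24 ∷ 44 ∷ []) ∷ (8 ∷ 23 ∷ 37 ∷ 41 ∷ []) ∷ (8 ∷ 28 ∷ 55 ∷ 61 ∷ []) ∷ (8 ∷ 33 ∷ 60 ∷ 68 ∷ [])
    ∷ (8 ∷ 34 ∷ 51 ∷ 73 ∷ []) ∷ (8 ∷ 35 ∷ 62 ∷ 69 ∷ []) ∷ (8 ∷ 39 ∷ 67 ∷ 70 ∷ []) ∷ (8 ∷ 48 ∷ 56 ∷ 64 ∷ [])
    ∷ (9 ∷ 10 ∷ 54 ∷ 64 ∷ []) ∷ (9 ∷ 11 ∷ 28 ∷ 30 ∷ []) ∷ (9 ∷ 12 ∷ 46 ∷ 56 ∷ []) ∷ (9 ∷ 13 ∷ 16 ∷ 36 ∷ [])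
    ∷ (9 ∷ 14 ∷ 26 ∷ 32 ∷ []) ∷ (9 ∷ 15 ∷ 17 ∷ 20 ∷ []) ∷ (9 ∷ 18 ∷ 37 ∷ 67 ∷ []) ∷ (9 ∷ 19 ∷ 47 ∷ 57 ∷ [])
    ∷ (9 ∷ 21 ∷ 25 ∷ 39 ∷ []) ∷ (9 ∷ 22 ∷ 45 ∷ 72 ∷ []) ∷ (9 ∷ 29 ∷ 51 ∷ 65 ∷ []) ∷ (9 ∷ 33 ∷ 62 ∷ 66 ∷ [])
    ∷ (9 ∷ 34 ∷ 68 ∷ 70 ∷ []) ∷ (9 ∷ 35 ∷ 44 ∷ 63 ∷ []) ∷ (9 ∷ 38 ∷ 55 ∷ 69 ∷ []) ∷ (9 ∷ 42 ∷ 50 ∷ 59 ∷ [])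
    ∷ (10 ∷ 12 ∷ 25 ∷ 28 ∷ []) ∷ (10 ∷ 13 ∷ 26 ∷ 59 ∷ []) ∷ (10 ∷ 14 ∷ 20 ∷ 51 ∷ []) ∷ (10 ∷ 15 ∷ 35 ∷ 45 ∷ [])
    ∷ (10 ∷ 16 ∷ 42 ∷ 58 ∷ []) ∷ (10 ∷ 17 ∷ 68 ∷ 73 ∷ []) ∷ (10 ∷ 21 ∷ 48 ∷ 71 ∷ []) ∷ (10 ∷ 22 ∷ 27 ∷ 34 ∷ [])
    ∷ (10 ∷ 30 ∷ 56 ∷ 60 ∷ []) ∷ (10 ∷ 33 ∷ 53 ∷ 55 ∷ []) ∷ (10 ∷ 37 ∷ 49 ∷ 61 ∷ []) ∷ (10 ∷ 39 ∷ 46 ∷ 57 ∷ [])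
    ∷ (10 ∷ 40 ∷ 52 ∷ 69 ∷ []) ∷ (10 ∷ 43 ∷ 44 ∷ 66 ∷ []) ∷ (11 ∷ 12 ∷ 27 ∷ 64 ∷ []) ∷ (11 ∷ 13 ∷ 24 ∷ 29 ∷ [])
    ∷ (11 ∷ 14 ∷ 41 ∷ 70 ∷ []) ∷ (11 ∷ 15 ∷ 21 ∷ 55 ∷ []) ∷ (11 ∷ 16 ∷ 38 ∷ 62 ∷ []) ∷ (11 ∷ 17 ∷ 48 ∷ 52 ∷ [])
    ∷ (11 ∷ 20 ∷ 36 ∷ 42 ∷ []) ∷ (11 ∷ 23 ∷ 26 ∷ 69 ∷ []) ∷ (11 ∷ 31 ∷ 50 ∷ 66 ∷ []) ∷ (11 ∷ 33 ∷ 51 ∷ 57 ∷ [])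
    ∷ (11 ∷ 34 ∷ 46 ∷ 58 ∷ []) ∷ (11 ∷ 39 ∷ 47 ∷ 60 ∷ []) ∷ (11 ∷ 40 ∷ 44 ∷ 53 ∷ []) ∷ (11 ∷ 54 ∷ 65 ∷ 72 ∷ [])
    ∷ (12 ∷ 14 ∷ 24 ∷ 31 ∷ []) ∷ (12 ∷ 15 ∷ 34 ∷ 59 ∷ []) ∷ (12 ∷ 16 ∷ 47 ∷ 51 ∷ []) ∷ (12 ∷ 20 ∷ 53 ∷ 63 ∷ [])
    ∷ (12 ∷ 21 ∷ 37 ∷ 43 ∷ []) ∷ (12 ∷ 22 ∷ 26 ∷ 54 ∷ []) ∷ (12 ∷ 30 ∷ 35 ∷ 65 ∷ []) ∷ (12 ∷ 33 ∷ 36 ∷ 73 ∷ [])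
    ∷ (12 ∷ 38 ∷ 39 ∷ 45 ∷ []) ∷ (12 ∷ 41 ∷ 49 ∷ 72 ∷ []) ∷ (12 ∷ 42 ∷ 44 ∷ 61 ∷ []) ∷ (12 ∷ 58 ∷ 66 ∷ 69 ∷ [])
    ∷ (13 ∷ 14 ∷ 64 ∷ 69 ∷ []) ∷ (13 ∷ 15 ∷ 25 ∷ 30 ∷ []) ∷ (13 ∷ 17 ∷ 43 ∷ 55 ∷ []) ∷ (13 ∷ 20 ∷ 47 ∷ 72 ∷ [])
    ∷ (13 ∷ 21 ∷ 57 ∷ 67 ∷ []) ∷ (13 ∷ 23 ∷ 27 ∷ 49 ∷ []) ∷ (13 ∷ 31 ∷ 61 ∷ 70 ∷ []) ∷ (13 ∷ 33 ∷ 38 ∷ 71 ∷ [])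
    ∷ (13 ∷ 34 ∷ 52 ∷ 60 ∷ []) ∷ (13 ∷ 37 ∷ 45 ∷ 54 ∷ []) ∷ (13 ∷ 39 ∷ 48 ∷ 65 ∷ []) ∷ (13 ∷ 41 ∷ 44 ∷ 73 ∷ [])
    ∷ (14 ∷ 17 ∷ 29 ∷ 44 ∷ []) ∷ (14 ∷ 18 ∷ 52 ∷ 68 ∷ []) ∷ (14 ∷ 19 ∷ 42 ∷ 73 ∷ []) ∷ (14 ∷ 23 ∷ 40 ∷ 58 ∷ [])
    ∷ (14 ∷ 25 ∷ 36 ∷ 66 ∷ []) ∷ (14 ∷ 33 ∷ 63 ∷ 65 ∷ []) ∷ (14 ∷ 35 ∷ 47 ∷ 59 ∷ []) ∷ (14 ∷ 39 ∷ 50 ∷ 62 ∷ [])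
    ∷ (14 ∷ 49 ∷ 56 ∷ 67 ∷ []) ∷ (14 ∷ 53 ∷ 54 ∷ 71 ∷ []) ∷ (15 ∷ 16 ∷ 28 ∷ 39 ∷ []) ∷ (15 ∷ 18 ∷ 38 ∷ 48 ∷ [])
    ∷ (15 ∷ 19 ∷ 58 ∷ 62 ∷ []) ∷ (15 ∷ 22 ∷ 46 ∷ 52 ∷ []) ∷ (15 ∷ 24 ∷ 60 ∷ 71 ∷ []) ∷ (15 ∷ 33 ∷ 61 ∷ 67 ∷ [])
    ∷ (15 ∷ 36 ∷ 49 ∷ 57 ∷ []) ∷ (15 ∷ 43 ∷ 64 ∷ 70 ∷ []) ∷ (15 ∷ 44 ∷ 56 ∷ 68 ∷ []) ∷ (15 ∷ 50 ∷ 54 ∷ 63 ∷ [])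
    ∷ (16 ∷ 18 ∷ 44 ∷ 69 ∷ []) ∷ (16 ∷ 19 ∷ 55 ∷ 60 ∷ []) ∷ (16 ∷ 22 ∷ 41 ∷ 56 ∷ []) ∷ (16 ∷ 23 ∷ 34 ∷ 64 ∷ [])
    ∷ (16 ∷ 24 ∷ 33 ∷ 54 ∷ []) ∷ (16 ∷ 25 ∷ 46 ∷ 65 ∷ []) ∷ (16 ∷ 26 ∷ 48 ∷ 61 ∷ []) ∷ (16 ∷ 27 ∷ 35 ∷ 53 ∷ [])
    ∷ (16 ∷ 30 ∷ 52 ∷ 71 ∷ []) ∷ (16 ∷ 31 ∷ 40 ∷ 67 ∷ []) ∷ (16 ∷ 32 ∷ 37 ∷ 73 ∷ []) ∷ (16 ∷ 45 ∷ 49 ∷ 66 ∷ [])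
    ∷ (17 ∷ 18 ∷ 51 ∷ 66 ∷ []) ∷ (17 ∷ 19 ∷ 34 ∷ 39 ∷ []) ∷ (17 ∷ 22 ∷ 59 ∷ 69 ∷ []) ∷ (17 ∷ 23 ∷ 45 ∷ 50 ∷ [])
    ∷ (17 ∷ 24 ∷ 40 ∷ 61 ∷ []) ∷ (17 ∷ 25 ∷ 33 ∷ 49 ∷ []) ∷ (17 ∷ 26 ∷ 57 ∷ 70 ∷ []) ∷ (17 ∷ 27 ∷ 42 ∷ 65 ∷ [])
    ∷ (17 ∷ 30 ∷ 46 ∷ 63 ∷ []) ∷ (17 ∷ 31 ∷ 36 ∷ 58 ∷ []) ∷ (17 ∷ 32 ∷ 38 ∷ 72 ∷ []) ∷ (17 ∷ 41 ∷ 54 ∷ 60 ∷ [])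
    ∷ (18 ∷ 20 ∷ 39 ∷ 54 ∷ []) ∷ (18 ∷ 21 ∷ 36 ∷ 65 ∷ []) ∷ (18 ∷ 24 ∷ 50 ∷ 72 ∷ []) ∷ (18 ∷ 25 ∷ 40 ∷ 62 ∷ [])
    ∷ (18 ∷ 26 ∷ 33 ∷ 64 ∷ []) ∷ (18 ∷ 27 ∷ 56 ∷ 70 ∷ []) ∷ (18 ∷ 28 ∷ 35 ∷ 58 ∷ []) ∷ (18 ∷ 29 ∷ 45 ∷ 63 ∷ [])
    ∷ (18 ∷ 32 ∷ 42 ∷ 47 ∷ []) ∷ (18 ∷ 55 ∷ 59 ∷ 71 ∷ []) ∷ (19 ∷ 20 ∷ 61 ∷ 71 ∷ []) ∷ (19 ∷ 21 ∷ 44 ∷ 49 ∷ [])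
    ∷ (19 ∷ 24 ∷ 46 ∷ 68 ∷ []) ∷ (19 ∷ 25 ∷ 37 ∷ 56 ∷ []) ∷ (19 ∷ 26 ∷ 35 ∷ 50 ∷ []) ∷ (19 ∷ 27 ∷ 33 ∷ 59 ∷ [])
    ∷ (19 ∷ 28 ∷ 41 ∷ 67 ∷ []) ∷ (19 ∷ 29 ∷ 52 ∷ 70 ∷ []) ∷ (19 ∷ 32 ∷ 43 ∷ 48 ∷ []) ∷ (19 ∷ 36 ∷ 51 ∷ 64 ∷ [])
    ∷ (20 ∷ 22 ∷ 49 ∷ 64 ∷ []) ∷ (20 ∷ 23 ∷ 46 ∷ 70 ∷ []) ∷ (20 ∷ 26 ∷ 43 ∷ 60 ∷ []) ∷ (20 ∷ 27 ∷ 38 ∷ 50 ∷ [])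
    ∷ (20 ∷ 28 ∷ 33 ∷ 69 ∷ []) ∷ (20 ∷ 29 ∷ 41 ∷ 66 ∷ []) ∷ (20 ∷ 30 ∷ 45 ∷ 68 ∷ []) ∷ (20 ∷ 31 ∷ 37 ∷ 55 ∷ [])
    ∷ (20 ∷ 32 ∷ 52 ∷ 57 ∷ []) ∷ (20 ∷ 34 ∷ 40 ∷ 65 ∷ []) ∷ (21 ∷ 22 ∷ 35 ∷ 40 ∷ []) ∷ (21 ∷ 23 ∷ 54 ∷ 59 ∷ [])
    ∷ (21 ∷ 26 ∷ 56 ∷ 73 ∷ []) ∷ (21 ∷ 27 ∷ 47 ∷ 66 ∷ []) ∷ (21 ∷ 28 ∷ 45 ∷ 60 ∷ []) ∷ (21 ∷ 29 ∷ 33 ∷ 34 ∷ [])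
    ∷ (21 ∷ 30 ∷ 51 ∷ 72 ∷ []) ∷ (21 ∷ 31 ∷ 41 ∷ 62 ∷ []) ∷ (21 ∷ 32 ∷ 53 ∷ 58 ∷ []) ∷ (21 ∷ 46 ∷ 61 ∷ 69 ∷ [])
    ∷ (22 ∷ 24 ∷ 47 ∷ 65 ∷ []) ∷ (22 ∷ 25 ∷ 55 ∷ 73 ∷ []) ∷ (22 ∷ 28 ∷ 36 ∷ 53 ∷ []) ∷ (22 ∷ 29 ∷ 48 ∷ 60 ∷ [])
    ∷ (22 ∷ 30 ∷ 33 ∷ 39 ∷ []) ∷ (22 ∷ 31 ∷ 51 ∷ 71 ∷ []) ∷ (22 ∷ 32 ∷ 62 ∷ 67 ∷ []) ∷ (22 ∷ 44 ∷ 50 ∷ 70 ∷ [])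
    ∷ (23 ∷ 24 ∷ 38 ∷ 51 ∷ []) ∷ (23 ∷ 25 ∷ 43 ∷ 61 ∷ []) ∷ (23 ∷ 28 ∷ 42 ∷ 66 ∷ []) ∷ (23 ∷ 29 ∷ 57 ∷ 71 ∷ [])
    ∷ (23 ∷ 30 ∷ 36 ∷ 55 ∷ []) ∷ (23 ∷ 31 ∷ 33 ∷ 44 ∷ []) ∷ (23 ∷ 32 ∷ 63 ∷ 68 ∷ []) ∷ (23 ∷ 35 ∷ 39 ∷ 56 ∷ [])
    ∷ (24 ∷ 27 ∷ 57 ∷ 62 ∷ []) ∷ (24 ∷ 30 ∷ 43 ∷ 58 ∷ []) ∷ (24 ∷ 34 ∷ 48 ∷ 66 ∷ []) ∷ (24 ∷ 36 ∷ 56 ∷ 63 ∷ [])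
    ∷ (24 ∷ 37 ∷ 39 ∷ 53 ∷ []) ∷ (24 ∷ 42 ∷ 55 ∷ 70 ∷ []) ∷ (24 ∷ 45 ∷ 67 ∷ 69 ∷ []) ∷ (24 ∷ 52 ∷ 59 ∷ 73 ∷ [])
    ∷ (25 ∷ 26 ∷ 53 ∷ 68 ∷ []) ∷ (25 ∷ 31 ∷ 47 ∷ 52 ∷ []) ∷ (25 ∷ 34 ∷ 41 ∷ 63 ∷ []) ∷ (25 ∷ 35 ∷ 48 ∷ 51 ∷ [])
    ∷ (25 ∷ 38 ∷ 58 ∷ 64 ∷ []) ∷ (25 ∷ 42 ∷ 60 ∷ 69 ∷ []) ∷ (25 ∷ 44 ∷ 57 ∷ 72 ∷ []) ∷ (25 ∷ 50 ∷ 67 ∷ 71 ∷ [])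
    ∷ (26 ∷ 29 ∷ 38 ∷ 67 ∷ []) ∷ (26 ∷ 34 ∷ 42 ∷ 62 ∷ []) ∷ (26 ∷ 37 ∷ 46 ∷ 66 ∷ []) ∷ (26 ∷ 39 ∷ 55 ∷ 72 ∷ [])
    ∷ (26 ∷ 41 ∷ 52 ∷ 65 ∷ []) ∷ (26 ∷ 44 ∷ 58 ∷ 71 ∷ []) ∷ (26 ∷ 47 ∷ 49 ∷ 63 ∷ []) ∷ (27 ∷ 28 ∷ 63 ∷ 73 ∷ [])
    ∷ (27 ∷ 36 ∷ 39 ∷ 52 ∷ []) ∷ (27 ∷ 37 ∷ 44 ∷ 51 ∷ []) ∷ (27 ∷ 40 ∷ 60 ∷ 72 ∷ []) ∷ (27 ∷ 43 ∷ 54 ∷ 67 ∷ [])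
    ∷ (27 ∷ 45 ∷ 58 ∷ 61 ∷ []) ∷ (27 ∷ 48 ∷ 68 ∷ 69 ∷ []) ∷ (28 ∷ 31 ∷ 48 ∷ 72 ∷ []) ∷ (28 ∷ 37 ∷ 57 ∷ 59 ∷ [])
    ∷ (28 ∷ 38 ∷ 44 ∷ 52 ∷ []) ∷ (28 ∷ 40 ∷ 54 ∷ 68 ∷ []) ∷ (28 ∷ 43 ∷ 49 ∷ 65 ∷ []) ∷ (28 ∷ 47 ∷ 56 ∷ 71 ∷ [])
    ∷ (28 ∷ 51 ∷ 62 ∷ 70 ∷ []) ∷ (29 ∷ 30 ∷ 37 ∷ 42 ∷ []) ∷ (29 ∷ 35 ∷ 55 ∷ 68 ∷ []) ∷ (29 ∷ 36 ∷ 43 ∷ 50 ∷ [])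
    ∷ (29 ∷ 39 ∷ 58 ∷ 73 ∷ []) ∷ (29 ∷ 46 ∷ 49 ∷ 62 ∷ []) ∷ (29 ∷ 47 ∷ 54 ∷ 61 ∷ []) ∷ (29 ∷ 53 ∷ 64 ∷ 72 ∷ [])
    ∷ (30 ∷ 34 ∷ 47 ∷ 67 ∷ []) ∷ (30 ∷ 38 ∷ 41 ∷ 61 ∷ []) ∷ (30 ∷ 40 ∷ 57 ∷ 66 ∷ []) ∷ (30 ∷ 48 ∷ 54 ∷ 62 ∷ [])
    ∷ (30 ∷ 50 ∷ 64 ∷ 73 ∷ []) ∷ (30 ∷ 53 ∷ 59 ∷ 70 ∷ []) ∷ (31 ∷ 35 ∷ 57 ∷ 64 ∷ []) ∷ (31 ∷ 38 ∷ 56 ∷ 59 ∷ [])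
    ∷ (31 ∷ 42 ∷ 49 ∷ 68 ∷ []) ∷ (31 ∷ 43 ∷ 63 ∷ 69 ∷ []) ∷ (31 ∷ 45 ∷ 65 ∷ 73 ∷ []) ∷ (31 ∷ 46 ∷ 53 ∷ 60 ∷ [])
    ∷ (32 ∷ 34 ∷ 50 ∷ 55 ∷ []) ∷ (32 ∷ 35 ∷ 49 ∷ 71 ∷ []) ∷ (32 ∷ 36 ∷ 54 ∷ 70 ∷ []) ∷ (32 ∷ 39 ∷ 61 ∷ 66 ∷ [])
    ∷ (32 ∷ 40 ∷ 45 ∷ 59 ∷ []) ∷ (32 ∷ 41 ∷ 46 ∷ 64 ∷ []) ∷ (32 ∷ 44 ∷ 60 ∷ 65 ∷ []) ∷ (32 ∷ 51 ∷ 56 ∷ 69 ∷ [])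
    ∷ (34 ∷ 49 ∷ 54 ∷ 69 ∷ []) ∷ (35 ∷ 43 ∷ 46 ∷ 73 ∷ []) ∷ (35 ∷ 60 ∷ 66 ∷ 70 ∷ []) ∷ (36 ∷ 41 ∷ 45 ∷ 71 ∷ [])
    ∷ (36 ∷ 61 ∷ 68 ∷ 72 ∷ []) ∷ (37 ∷ 52 ∷ 58 ∷ 72 ∷ []) ∷ (37 ∷ 62 ∷ 65 ∷ 71 ∷ []) ∷ (38 ∷ 40 ∷ 47 ∷ 70 ∷ [])
    ∷ (38 ∷ 53 ∷ 57 ∷ 73 ∷ []) ∷ (39 ∷ 44 ∷ 59 ∷ 64 ∷ []) ∷ (40 ∷ 46 ∷ 51 ∷ 55 ∷ []) ∷ (41 ∷ 48 ∷ 50 ∷ 57 ∷ [])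
    ∷ (42 ∷ 45 ∷ 53 ∷ 56 ∷ []) ∷ (42 ∷ 48 ∷ 63 ∷ 67 ∷ []) ∷ (43 ∷ 47 ∷ 62 ∷ 68 ∷ []) ∷ (50 ∷ 56 ∷ 61 ∷ 65 ∷ [])
    ∷ (51 ∷ 58 ∷ 60 ∷ 67 ∷ []) ∷ (52 ∷ 55 ∷ 63 ∷ 66 ∷ [])
    ∷ []

  blocks-2⁷5¹² : List (Block 7 12)
  blocks-2⁷5¹² =
      (0 ∷ 2 ∷ 4 ∷ 13 ∷ []) ∷ (0 ∷ 3 ∷ 6 ∷ 12 ∷ []) ∷ (0 ∷ 5 ∷ 39 ∷ 62 ∷ []) ∷ (0 ∷ 7 ∷ 21 ∷ 49 ∷ [])
    ∷ (0 ∷ 8 ∷ 17 ∷ 59 ∷ []) ∷ (0 ∷ 9 ∷ 14 ∷ 61 ∷ []) ∷ (0 ∷ 10 ∷ 32 ∷ 72 ∷ []) ∷ (0 ∷ 11 ∷ 16 ∷ 71 ∷ [])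
    ∷ (0 ∷ 15 ∷ 27 ∷ 68 ∷ []) ∷ (0 ∷ 18 ∷ 57 ∷ 65 ∷ []) ∷ (0 ∷ 19 ∷ 46 ∷ 63 ∷ []) ∷ (0 ∷ 20 ∷ 30 ∷ 42 ∷ [])
    ∷ (0 ∷ 22 ∷ 28 ∷ 60 ∷ []) ∷ (0 ∷ 23 ∷ 38 ∷ 51 ∷ []) ∷ (0 ∷ 24 ∷ 41 ∷ 73 ∷ []) ∷ (0 ∷ 25 ∷ 48 ∷ 56 ∷ [])
    ∷ (0 ∷ 26 ∷ 29 ∷ 35 ∷ []) ∷ (0 ∷ 31 ∷ 50 ∷ 66 ∷ []) ∷ (0 ∷ 33 ∷ 47 ∷ 54 ∷ []) ∷ (0 ∷ 34 ∷ 43 ∷ 70 ∷ [])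
    ∷ (0 ∷ 36 ∷ 40 ∷ 55 ∷ []) ∷ (0 ∷ 37 ∷ 45 ∷ 58 ∷ []) ∷ (0 ∷ 44 ∷ 53 ∷ 67 ∷ []) ∷ (0 ∷ 52 ∷ 64 ∷ 69 ∷ [])
    ∷ (1 ∷ 2 ∷ 32 ∷ 49 ∷ []) ∷ (1 ∷ 3 ∷ 29 ∷ 51 ∷ []) ∷ (1 ∷ 4 ∷ 9 ∷ 12 ∷ []) ∷ (1 ∷ 5 ∷ 41 ∷ 59 ∷ [])
    ∷ (1 ∷ 6 ∷ 8 ∷ 13 ∷ []) ∷ (1 ∷ 7 ∷ 19 ∷ 52 ∷ []) ∷ (1 ∷ 10 ∷ 31 ∷ 56 ∷ []) ∷ (1 ∷ 11 ∷ 17 ∷ 57 ∷ [])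
    ∷ (1 ∷ 14 ∷ 25 ∷ 36 ∷ []) ∷ (1 ∷ 15 ∷ 22 ∷ 40 ∷ []) ∷ (1 ∷ 16 ∷ 46 ∷ 60 ∷ []) ∷ (1 ∷ 18 ∷ 67 ∷ 69 ∷ [])
    ∷ (1 ∷ 20 ∷ 26 ∷ 70 ∷ []) ∷ (1 ∷ 21 ∷ 34 ∷ 58 ∷ []) ∷ (1 ∷ 23 ∷ 24 ∷ 55 ∷ []) ∷ (1 ∷ 27 ∷ 65 ∷ 73 ∷ [])
    ∷ (1 ∷ 28 ∷ 43 ∷ 61 ∷ []) ∷ (1 ∷ 30 ∷ 37 ∷ 48 ∷ []) ∷ (1 ∷ 33 ∷ 45 ∷ 72 ∷ []) ∷ (1 ∷ 35 ∷ 68 ∷ 71 ∷ [])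
    ∷ (1 ∷ 38 ∷ 42 ∷ 50 ∷ []) ∷ (1 ∷ 39 ∷ 53 ∷ 66 ∷ []) ∷ (1 ∷ 44 ∷ 54 ∷ 62 ∷ []) ∷ (1 ∷ 47 ∷ 63 ∷ 64 ∷ [])
    ∷ (2 ∷ 5 ∷ 10 ∷ 12 ∷ []) ∷ (2 ∷ 6 ∷ 19 ∷ 31 ∷ []) ∷ (2 ∷ 7 ∷ 22 ∷ 29 ∷ []) ∷ (2 ∷ 8 ∷ 21 ∷ 41 ∷ [])
    ∷ (2 ∷ 9 ∷ 42 ∷ 47 ∷ []) ∷ (2 ∷ 11 ∷ 26 ∷ 69 ∷ []) ∷ (2 ∷ 14 ∷ 43 ∷ 51 ∷ []) ∷ (2 ∷ 15 ∷ 63 ∷ 66 ∷ [])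
    ∷ (2 ∷ 16 ∷ 44 ∷ 55 ∷ []) ∷ (2 ∷ 17 ∷ 20 ∷ 38 ∷ []) ∷ (2 ∷ 18 ∷ 27 ∷ 30 ∷ []) ∷ (2 ∷ 23 ∷ 35 ∷ 67 ∷ [])
    ∷ (2 ∷ 24 ∷ 33 ∷ 61 ∷ []) ∷ (2 ∷ 25 ∷ 45 ∷ 52 ∷ []) ∷ (2 ∷ 28 ∷ 58 ∷ 71 ∷ []) ∷ (2 ∷ 34 ∷ 39 ∷ 72 ∷ [])
    ∷ (2 ∷ 36 ∷ 46 ∷ 70 ∷ []) ∷ (2 ∷ 37 ∷ 59 ∷ 73 ∷ []) ∷ (2 ∷ 40 ∷ 53 ∷ 54 ∷ []) ∷ (2 ∷ 48 ∷ 62 ∷ 64 ∷ [])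
    ∷ (2 ∷ 50 ∷ 56 ∷ 65 ∷ []) ∷ (2 ∷ 57 ∷ 60 ∷ 68 ∷ []) ∷ (3 ∷ 4 ∷ 47 ∷ 69 ∷ []) ∷ (3 ∷ 5 ∷ 44 ∷ 71 ∷ [])
    ∷ (3 ∷ 7 ∷ 10 ∷ 13 ∷ []) ∷ (3 ∷ 8 ∷ 22 ∷ 67 ∷ []) ∷ (3 ∷ 9 ∷ 46 ∷ 66 ∷ []) ∷ (3 ∷ 11 ∷ 24 ∷ 72 ∷ [])
    ∷ (3 ∷ 14 ∷ 28 ∷ 65 ∷ []) ∷ (3 ∷ 15 ∷ 19 ∷ 56 ∷ []) ∷ (3 ∷ 16 ∷ 25 ∷ 40 ∷ []) ∷ (3 ∷ 17 ∷ 35 ∷ 43 ∷ [])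
    ∷ (3 ∷ 18 ∷ 31 ∷ 53 ∷ []) ∷ (3 ∷ 20 ∷ 27 ∷ 50 ∷ []) ∷ (3 ∷ 21 ∷ 30 ∷ 61 ∷ []) ∷ (3 ∷ 23 ∷ 37 ∷ 39 ∷ [])
    ∷ (3 ∷ 26 ∷ 54 ∷ 68 ∷ []) ∷ (3 ∷ 32 ∷ 59 ∷ 64 ∷ []) ∷ (3 ∷ 33 ∷ 34 ∷ 62 ∷ []) ∷ (3 ∷ 36 ∷ 49 ∷ 73 ∷ [])
    ∷ (3 ∷ 38 ∷ 41 ∷ 55 ∷ []) ∷ (3 ∷ 42 ∷ 48 ∷ 60 ∷ []) ∷ (3 ∷ 45 ∷ 57 ∷ 63 ∷ []) ∷ (3 ∷ 52 ∷ 58 ∷ 70 ∷ [])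
    ∷ (4 ∷ 6 ∷ 52 ∷ 62 ∷ []) ∷ (4 ∷ 7 ∷ 26 ∷ 51 ∷ []) ∷ (4 ∷ 8 ∷ 16 ∷ 39 ∷ []) ∷ (4 ∷ 10 ∷ 24 ∷ 46 ∷ [])
    ∷ (4 ∷ 11 ∷ 27 ∷ 44 ∷ []) ∷ (4 ∷ 14 ∷ 31 ∷ 48 ∷ []) ∷ (4 ∷ 15 ∷ 60 ∷ 72 ∷ []) ∷ (4 ∷ 17 ∷ 23 ∷ 45 ∷ [])
    ∷ (4 ∷ 18 ∷ 41 ∷ 68 ∷ []) ∷ (4 ∷ 19 ∷ 53 ∷ 71 ∷ []) ∷ (4 ∷ 20 ∷ 33 ∷ 36 ∷ []) ∷ (4 ∷ 21 ∷ 59 ∷ 65 ∷ [])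
    ∷ (4 ∷ 22 ∷ 25 ∷ 58 ∷ []) ∷ (4 ∷ 28 ∷ 37 ∷ 55 ∷ []) ∷ (4 ∷ 29 ∷ 43 ∷ 57 ∷ []) ∷ (4 ∷ 30 ∷ 38 ∷ 67 ∷ [])
    ∷ (4 ∷ 32 ∷ 34 ∷ 63 ∷ []) ∷ (4 ∷ 35 ∷ 66 ∷ 70 ∷ []) ∷ (4 ∷ 40 ∷ 56 ∷ 61 ∷ []) ∷ (4 ∷ 42 ∷ 49 ∷ 54 ∷ [])
    ∷ (4 ∷ 50 ∷ 64 ∷ 73 ∷ []) ∷ (5 ∷ 6 ∷ 36 ∷ 61 ∷ []) ∷ (5 ∷ 7 ∷ 27 ∷ 37 ∷ []) ∷ (5 ∷ 8 ∷ 14 ∷ 42 ∷ [])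
    ∷ (5 ∷ 9 ∷ 11 ∷ 13 ∷ []) ∷ (5 ∷ 15 ∷ 21 ∷ 50 ∷ []) ∷ (5 ∷ 16 ∷ 38 ∷ 64 ∷ []) ∷ (5 ∷ 17 ∷ 25 ∷ 70 ∷ [])
    ∷ (5 ∷ 18 ∷ 19 ∷ 35 ∷ []) ∷ (5 ∷ 20 ∷ 24 ∷ 66 ∷ []) ∷ (5 ∷ 22 ∷ 53 ∷ 55 ∷ []) ∷ (5 ∷ 23 ∷ 46 ∷ 73 ∷ [])
    ∷ (5 ∷ 26 ∷ 31 ∷ 45 ∷ []) ∷ (5 ∷ 28 ∷ 49 ∷ 57 ∷ []) ∷ (5 ∷ 29 ∷ 34 ∷ 47 ∷ []) ∷ (5 ∷ 30 ∷ 52 ∷ 63 ∷ [])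
    ∷ (5 ∷ 32 ∷ 48 ∷ 54 ∷ []) ∷ (5 ∷ 33 ∷ 60 ∷ 67 ∷ []) ∷ (5 ∷ 40 ∷ 68 ∷ 72 ∷ []) ∷ (5 ∷ 43 ∷ 56 ∷ 69 ∷ [])
    ∷ (5 ∷ 51 ∷ 58 ∷ 65 ∷ []) ∷ (6 ∷ 9 ∷ 54 ∷ 67 ∷ []) ∷ (6 ∷ 10 ∷ 37 ∷ 64 ∷ []) ∷ (6 ∷ 11 ∷ 34 ∷ 66 ∷ [])
    ∷ (6 ∷ 14 ∷ 23 ∷ 72 ∷ []) ∷ (6 ∷ 15 ∷ 28 ∷ 47 ∷ []) ∷ (6 ∷ 16 ∷ 29 ∷ 68 ∷ []) ∷ (6 ∷ 17 ∷ 24 ∷ 53 ∷ [])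
    ∷ (6 ∷ 18 ∷ 26 ∷ 40 ∷ []) ∷ (6 ∷ 20 ∷ 51 ∷ 71 ∷ []) ∷ (6 ∷ 21 ∷ 33 ∷ 48 ∷ []) ∷ (6 ∷ 22 ∷ 59 ∷ 69 ∷ [])
    ∷ (6 ∷ 25 ∷ 46 ∷ 55 ∷ []) ∷ (6 ∷ 27 ∷ 38 ∷ 70 ∷ []) ∷ (6 ∷ 30 ∷ 50 ∷ 57 ∷ []) ∷ (6 ∷ 32 ∷ 43 ∷ 65 ∷ [])
    ∷ (6 ∷ 35 ∷ 42 ∷ 73 ∷ []) ∷ (6 ∷ 39 ∷ 56 ∷ 63 ∷ []) ∷ (6 ∷ 41 ∷ 45 ∷ 49 ∷ []) ∷ (6 ∷ 44 ∷ 58 ∷ 60 ∷ [])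
    ∷ (7 ∷ 8 ∷ 11 ∷ 12 ∷ []) ∷ (7 ∷ 9 ∷ 56 ∷ 64 ∷ []) ∷ (7 ∷ 14 ∷ 24 ∷ 67 ∷ []) ∷ (7 ∷ 15 ∷ 53 ∷ 62 ∷ [])
    ∷ (7 ∷ 16 ∷ 36 ∷ 65 ∷ []) ∷ (7 ∷ 17 ∷ 68 ∷ 69 ∷ []) ∷ (7 ∷ 18 ∷ 47 ∷ 50 ∷ []) ∷ (7 ∷ 20 ∷ 48 ∷ 57 ∷ [])
    ∷ (7 ∷ 23 ∷ 54 ∷ 71 ∷ []) ∷ (7 ∷ 25 ∷ 33 ∷ 39 ∷ []) ∷ (7 ∷ 28 ∷ 31 ∷ 44 ∷ []) ∷ (7 ∷ 30 ∷ 41 ∷ 60 ∷ [])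
    ∷ (7 ∷ 32 ∷ 35 ∷ 55 ∷ []) ∷ (7 ∷ 34 ∷ 40 ∷ 46 ∷ []) ∷ (7 ∷ 38 ∷ 59 ∷ 72 ∷ []) ∷ (7 ∷ 42 ∷ 63 ∷ 70 ∷ [])
    ∷ (7 ∷ 43 ∷ 58 ∷ 66 ∷ []) ∷ (7 ∷ 45 ∷ 61 ∷ 73 ∷ []) ∷ (8 ∷ 10 ∷ 36 ∷ 54 ∷ []) ∷ (8 ∷ 15 ∷ 33 ∷ 37 ∷ [])
    ∷ (8 ∷ 18 ∷ 34 ∷ 51 ∷ []) ∷ (8 ∷ 19 ∷ 24 ∷ 57 ∷ []) ∷ (8 ∷ 20 ∷ 63 ∷ 69 ∷ []) ∷ (8 ∷ 23 ∷ 29 ∷ 61 ∷ [])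
    ∷ (8 ∷ 25 ∷ 43 ∷ 47 ∷ []) ∷ (8 ∷ 26 ∷ 55 ∷ 66 ∷ []) ∷ (8 ∷ 27 ∷ 49 ∷ 58 ∷ []) ∷ (8 ∷ 28 ∷ 32 ∷ 40 ∷ [])
    ∷ (8 ∷ 30 ∷ 46 ∷ 53 ∷ []) ∷ (8 ∷ 31 ∷ 64 ∷ 70 ∷ []) ∷ (8 ∷ 35 ∷ 62 ∷ 65 ∷ []) ∷ (8 ∷ 38 ∷ 56 ∷ 73 ∷ [])
    ∷ (8 ∷ 44 ∷ 52 ∷ 68 ∷ []) ∷ (8 ∷ 45 ∷ 60 ∷ 71 ∷ []) ∷ (8 ∷ 48 ∷ 50 ∷ 72 ∷ []) ∷ (9 ∷ 10 ∷ 34 ∷ 57 ∷ [])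
    ∷ (9 ∷ 15 ∷ 41 ∷ 51 ∷ []) ∷ (9 ∷ 16 ∷ 33 ∷ 63 ∷ []) ∷ (9 ∷ 17 ∷ 44 ∷ 49 ∷ []) ∷ (9 ∷ 18 ∷ 24 ∷ 52 ∷ [])
    ∷ (9 ∷ 19 ∷ 27 ∷ 43 ∷ []) ∷ (9 ∷ 20 ∷ 31 ∷ 35 ∷ []) ∷ (9 ∷ 21 ∷ 28 ∷ 70 ∷ []) ∷ (9 ∷ 22 ∷ 50 ∷ 68 ∷ [])
    ∷ (9 ∷ 23 ∷ 25 ∷ 32 ∷ []) ∷ (9 ∷ 26 ∷ 58 ∷ 59 ∷ []) ∷ (9 ∷ 29 ∷ 38 ∷ 45 ∷ []) ∷ (9 ∷ 30 ∷ 39 ∷ 71 ∷ [])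
    ∷ (9 ∷ 36 ∷ 48 ∷ 69 ∷ []) ∷ (9 ∷ 37 ∷ 40 ∷ 60 ∷ []) ∷ (9 ∷ 53 ∷ 65 ∷ 72 ∷ []) ∷ (9 ∷ 55 ∷ 62 ∷ 73 ∷ [])
    ∷ (10 ∷ 14 ∷ 22 ∷ 73 ∷ []) ∷ (10 ∷ 15 ∷ 61 ∷ 65 ∷ []) ∷ (10 ∷ 16 ∷ 23 ∷ 50 ∷ []) ∷ (10 ∷ 17 ∷ 40 ∷ 58 ∷ [])
    ∷ (10 ∷ 18 ∷ 20 ∷ 62 ∷ []) ∷ (10 ∷ 19 ∷ 28 ∷ 42 ∷ []) ∷ (10 ∷ 21 ∷ 38 ∷ 44 ∷ []) ∷ (10 ∷ 25 ∷ 41 ∷ 71 ∷ [])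
    ∷ (10 ∷ 26 ∷ 48 ∷ 63 ∷ []) ∷ (10 ∷ 27 ∷ 29 ∷ 39 ∷ []) ∷ (10 ∷ 30 ∷ 59 ∷ 68 ∷ []) ∷ (10 ∷ 33 ∷ 49 ∷ 66 ∷ [])
    ∷ (10 ∷ 35 ∷ 47 ∷ 53 ∷ []) ∷ (10 ∷ 43 ∷ 52 ∷ 55 ∷ []) ∷ (10 ∷ 45 ∷ 67 ∷ 70 ∷ []) ∷ (10 ∷ 51 ∷ 60 ∷ 69 ∷ [])
    ∷ (11 ∷ 14 ∷ 19 ∷ 37 ∷ []) ∷ (11 ∷ 15 ∷ 48 ∷ 49 ∷ []) ∷ (11 ∷ 18 ∷ 46 ∷ 59 ∷ []) ∷ (11 ∷ 20 ∷ 32 ∷ 73 ∷ [])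
    ∷ (11 ∷ 21 ∷ 35 ∷ 56 ∷ []) ∷ (11 ∷ 22 ∷ 38 ∷ 39 ∷ []) ∷ (11 ∷ 23 ∷ 62 ∷ 70 ∷ []) ∷ (11 ∷ 25 ∷ 63 ∷ 67 ∷ [])
    ∷ (11 ∷ 28 ∷ 41 ∷ 64 ∷ []) ∷ (11 ∷ 29 ∷ 42 ∷ 58 ∷ []) ∷ (11 ∷ 30 ∷ 45 ∷ 51 ∷ []) ∷ (11 ∷ 31 ∷ 43 ∷ 60 ∷ [])
    ∷ (11 ∷ 33 ∷ 40 ∷ 52 ∷ []) ∷ (11 ∷ 36 ∷ 53 ∷ 68 ∷ []) ∷ (11 ∷ 47 ∷ 55 ∷ 65 ∷ []) ∷ (11 ∷ 50 ∷ 54 ∷ 61 ∷ [])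
    ∷ (12 ∷ 14 ∷ 34 ∷ 44 ∷ []) ∷ (12 ∷ 15 ∷ 35 ∷ 45 ∷ []) ∷ (12 ∷ 16 ∷ 41 ∷ 61 ∷ []) ∷ (12 ∷ 17 ∷ 37 ∷ 47 ∷ [])
    ∷ (12 ∷ 18 ∷ 23 ∷ 28 ∷ []) ∷ (12 ∷ 19 ∷ 54 ∷ 59 ∷ []) ∷ (12 ∷ 20 ∷ 55 ∷ 60 ∷ []) ∷ (12 ∷ 21 ∷ 31 ∷ 51 ∷ [])
    ∷ (12 ∷ 22 ∷ 57 ∷ 62 ∷ []) ∷ (12 ∷ 24 ∷ 29 ∷ 64 ∷ []) ∷ (12 ∷ 25 ∷ 30 ∷ 65 ∷ []) ∷ (12 ∷ 26 ∷ 46 ∷ 71 ∷ [])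
    ∷ (12 ∷ 27 ∷ 32 ∷ 67 ∷ []) ∷ (12 ∷ 33 ∷ 38 ∷ 43 ∷ []) ∷ (12 ∷ 36 ∷ 56 ∷ 66 ∷ []) ∷ (12 ∷ 39 ∷ 49 ∷ 69 ∷ [])
    ∷ (12 ∷ 40 ∷ 50 ∷ 70 ∷ []) ∷ (12 ∷ 42 ∷ 52 ∷ 72 ∷ []) ∷ (12 ∷ 48 ∷ 53 ∷ 58 ∷ []) ∷ (12 ∷ 63 ∷ 68 ∷ 73 ∷ [])
    ∷ (13 ∷ 14 ∷ 39 ∷ 59 ∷ []) ∷ (13 ∷ 15 ∷ 20 ∷ 25 ∷ []) ∷ (13 ∷ 16 ∷ 21 ∷ 26 ∷ []) ∷ (13 ∷ 17 ∷ 42 ∷ 62 ∷ [])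
    ∷ (13 ∷ 18 ∷ 38 ∷ 48 ∷ []) ∷ (13 ∷ 19 ∷ 29 ∷ 49 ∷ []) ∷ (13 ∷ 22 ∷ 32 ∷ 52 ∷ []) ∷ (13 ∷ 23 ∷ 58 ∷ 63 ∷ [])
    ∷ (13 ∷ 24 ∷ 44 ∷ 69 ∷ []) ∷ (13 ∷ 27 ∷ 47 ∷ 72 ∷ []) ∷ (13 ∷ 28 ∷ 33 ∷ 68 ∷ []) ∷ (13 ∷ 30 ∷ 35 ∷ 40 ∷ [])
    ∷ (13 ∷ 31 ∷ 36 ∷ 41 ∷ []) ∷ (13 ∷ 34 ∷ 54 ∷ 64 ∷ []) ∷ (13 ∷ 37 ∷ 57 ∷ 67 ∷ []) ∷ (13 ∷ 43 ∷ 53 ∷ 73 ∷ [])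
    ∷ (13 ∷ 45 ∷ 50 ∷ 55 ∷ []) ∷ (13 ∷ 46 ∷ 51 ∷ 56 ∷ []) ∷ (13 ∷ 60 ∷ 65 ∷ 70 ∷ []) ∷ (13 ∷ 61 ∷ 66 ∷ 71 ∷ [])
    ∷ (14 ∷ 20 ∷ 29 ∷ 40 ∷ []) ∷ (14 ∷ 21 ∷ 55 ∷ 63 ∷ []) ∷ (14 ∷ 26 ∷ 38 ∷ 60 ∷ []) ∷ (14 ∷ 27 ∷ 46 ∷ 64 ∷ [])
    ∷ (14 ∷ 30 ∷ 54 ∷ 70 ∷ []) ∷ (14 ∷ 32 ∷ 45 ∷ 53 ∷ []) ∷ (14 ∷ 33 ∷ 41 ∷ 56 ∷ []) ∷ (14 ∷ 35 ∷ 50 ∷ 69 ∷ [])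
    ∷ (14 ∷ 47 ∷ 49 ∷ 71 ∷ []) ∷ (14 ∷ 52 ∷ 57 ∷ 66 ∷ []) ∷ (14 ∷ 58 ∷ 62 ∷ 68 ∷ []) ∷ (15 ∷ 23 ∷ 34 ∷ 52 ∷ [])
    ∷ (15 ∷ 24 ∷ 59 ∷ 70 ∷ []) ∷ (15 ∷ 26 ∷ 43 ∷ 67 ∷ []) ∷ (15 ∷ 29 ∷ 55 ∷ 69 ∷ []) ∷ (15 ∷ 30 ∷ 44 ∷ 64 ∷ [])
    ∷ (15 ∷ 31 ∷ 39 ∷ 73 ∷ []) ∷ (15 ∷ 32 ∷ 36 ∷ 58 ∷ []) ∷ (15 ∷ 38 ∷ 46 ∷ 54 ∷ []) ∷ (15 ∷ 42 ∷ 57 ∷ 71 ∷ [])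
    ∷ (16 ∷ 19 ∷ 30 ∷ 58 ∷ []) ∷ (16 ∷ 20 ∷ 37 ∷ 53 ∷ []) ∷ (16 ∷ 22 ∷ 43 ∷ 45 ∷ []) ∷ (16 ∷ 24 ∷ 35 ∷ 48 ∷ [])
    ∷ (16 ∷ 27 ∷ 52 ∷ 56 ∷ []) ∷ (16 ∷ 28 ∷ 51 ∷ 59 ∷ []) ∷ (16 ∷ 31 ∷ 57 ∷ 72 ∷ []) ∷ (16 ∷ 32 ∷ 47 ∷ 70 ∷ [])
    ∷ (16 ∷ 34 ∷ 42 ∷ 69 ∷ []) ∷ (16 ∷ 49 ∷ 62 ∷ 67 ∷ []) ∷ (16 ∷ 54 ∷ 66 ∷ 73 ∷ []) ∷ (17 ∷ 19 ∷ 34 ∷ 61 ∷ [])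
    ∷ (17 ∷ 21 ∷ 66 ∷ 72 ∷ []) ∷ (17 ∷ 22 ∷ 51 ∷ 64 ∷ []) ∷ (17 ∷ 26 ∷ 30 ∷ 73 ∷ []) ∷ (17 ∷ 27 ∷ 41 ∷ 54 ∷ [])
    ∷ (17 ∷ 28 ∷ 39 ∷ 48 ∷ []) ∷ (17 ∷ 29 ∷ 63 ∷ 65 ∷ []) ∷ (17 ∷ 31 ∷ 55 ∷ 67 ∷ []) ∷ (17 ∷ 32 ∷ 56 ∷ 71 ∷ [])
    ∷ (17 ∷ 33 ∷ 46 ∷ 50 ∷ []) ∷ (17 ∷ 36 ∷ 52 ∷ 60 ∷ []) ∷ (18 ∷ 21 ∷ 29 ∷ 71 ∷ []) ∷ (18 ∷ 22 ∷ 49 ∷ 63 ∷ [])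
    ∷ (18 ∷ 25 ∷ 42 ∷ 64 ∷ []) ∷ (18 ∷ 32 ∷ 60 ∷ 66 ∷ []) ∷ (18 ∷ 33 ∷ 58 ∷ 73 ∷ []) ∷ (18 ∷ 36 ∷ 39 ∷ 45 ∷ [])
    ∷ (18 ∷ 37 ∷ 43 ∷ 54 ∷ []) ∷ (18 ∷ 44 ∷ 56 ∷ 70 ∷ []) ∷ (18 ∷ 55 ∷ 61 ∷ 72 ∷ []) ∷ (19 ∷ 25 ∷ 44 ∷ 50 ∷ [])
    ∷ (19 ∷ 26 ∷ 33 ∷ 65 ∷ []) ∷ (19 ∷ 32 ∷ 38 ∷ 68 ∷ []) ∷ (19 ∷ 36 ∷ 67 ∷ 72 ∷ []) ∷ (19 ∷ 39 ∷ 55 ∷ 70 ∷ [])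
    ∷ (19 ∷ 40 ∷ 45 ∷ 64 ∷ []) ∷ (19 ∷ 41 ∷ 62 ∷ 69 ∷ []) ∷ (19 ∷ 47 ∷ 60 ∷ 73 ∷ []) ∷ (19 ∷ 48 ∷ 51 ∷ 66 ∷ [])
    ∷ (20 ∷ 28 ∷ 54 ∷ 72 ∷ []) ∷ (20 ∷ 34 ∷ 45 ∷ 59 ∷ []) ∷ (20 ∷ 39 ∷ 44 ∷ 65 ∷ []) ∷ (20 ∷ 41 ∷ 52 ∷ 67 ∷ [])
    ∷ (20 ∷ 43 ∷ 46 ∷ 49 ∷ []) ∷ (20 ∷ 47 ∷ 56 ∷ 68 ∷ []) ∷ (20 ∷ 58 ∷ 61 ∷ 64 ∷ []) ∷ (21 ∷ 24 ∷ 45 ∷ 68 ∷ [])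
    ∷ (21 ∷ 25 ∷ 57 ∷ 73 ∷ []) ∷ (21 ∷ 27 ∷ 53 ∷ 60 ∷ []) ∷ (21 ∷ 32 ∷ 37 ∷ 69 ∷ []) ∷ (21 ∷ 36 ∷ 43 ∷ 64 ∷ [])
    ∷ (21 ∷ 39 ∷ 52 ∷ 54 ∷ []) ∷ (21 ∷ 40 ∷ 47 ∷ 62 ∷ []) ∷ (21 ∷ 42 ∷ 46 ∷ 67 ∷ []) ∷ (22 ∷ 24 ∷ 31 ∷ 54 ∷ [])
    ∷ (22 ∷ 26 ∷ 36 ∷ 42 ∷ []) ∷ (22 ∷ 27 ∷ 34 ∷ 71 ∷ []) ∷ (22 ∷ 30 ∷ 56 ∷ 72 ∷ []) ∷ (22 ∷ 33 ∷ 35 ∷ 44 ∷ [])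
    ∷ (22 ∷ 37 ∷ 46 ∷ 65 ∷ []) ∷ (22 ∷ 41 ∷ 47 ∷ 66 ∷ []) ∷ (22 ∷ 48 ∷ 61 ∷ 70 ∷ []) ∷ (23 ∷ 26 ∷ 41 ∷ 44 ∷ [])
    ∷ (23 ∷ 27 ∷ 33 ∷ 69 ∷ []) ∷ (23 ∷ 30 ∷ 36 ∷ 47 ∷ []) ∷ (23 ∷ 31 ∷ 42 ∷ 65 ∷ []) ∷ (23 ∷ 40 ∷ 59 ∷ 66 ∷ [])
    ∷ (23 ∷ 43 ∷ 48 ∷ 68 ∷ []) ∷ (23 ∷ 49 ∷ 56 ∷ 60 ∷ []) ∷ (23 ∷ 53 ∷ 57 ∷ 64 ∷ []) ∷ (24 ∷ 30 ∷ 43 ∷ 62 ∷ [])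
    ∷ (24 ∷ 32 ∷ 39 ∷ 51 ∷ []) ∷ (24 ∷ 34 ∷ 50 ∷ 60 ∷ []) ∷ (24 ∷ 36 ∷ 63 ∷ 71 ∷ []) ∷ (24 ∷ 37 ∷ 42 ∷ 56 ∷ [])
    ∷ (24 ∷ 38 ∷ 47 ∷ 58 ∷ []) ∷ (24 ∷ 40 ∷ 49 ∷ 65 ∷ []) ∷ (25 ∷ 29 ∷ 54 ∷ 60 ∷ []) ∷ (25 ∷ 31 ∷ 34 ∷ 68 ∷ [])
    ∷ (25 ∷ 35 ∷ 49 ∷ 59 ∷ []) ∷ (25 ∷ 37 ∷ 51 ∷ 72 ∷ []) ∷ (25 ∷ 38 ∷ 62 ∷ 66 ∷ []) ∷ (25 ∷ 53 ∷ 61 ∷ 69 ∷ [])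
    ∷ (26 ∷ 32 ∷ 50 ∷ 62 ∷ []) ∷ (26 ∷ 34 ∷ 53 ∷ 56 ∷ []) ∷ (26 ∷ 37 ∷ 52 ∷ 61 ∷ []) ∷ (26 ∷ 39 ∷ 47 ∷ 57 ∷ [])
    ∷ (26 ∷ 49 ∷ 64 ∷ 72 ∷ []) ∷ (27 ∷ 31 ∷ 40 ∷ 63 ∷ []) ∷ (27 ∷ 35 ∷ 57 ∷ 61 ∷ []) ∷ (27 ∷ 36 ∷ 51 ∷ 62 ∷ [])
    ∷ (27 ∷ 42 ∷ 45 ∷ 66 ∷ []) ∷ (27 ∷ 48 ∷ 55 ∷ 59 ∷ []) ∷ (28 ∷ 29 ∷ 36 ∷ 50 ∷ []) ∷ (28 ∷ 30 ∷ 66 ∷ 69 ∷ [])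
    ∷ (28 ∷ 34 ∷ 67 ∷ 73 ∷ []) ∷ (28 ∷ 35 ∷ 46 ∷ 52 ∷ []) ∷ (28 ∷ 38 ∷ 53 ∷ 63 ∷ []) ∷ (28 ∷ 45 ∷ 56 ∷ 62 ∷ [])
    ∷ (29 ∷ 37 ∷ 44 ∷ 66 ∷ []) ∷ (29 ∷ 41 ∷ 53 ∷ 70 ∷ []) ∷ (29 ∷ 46 ∷ 62 ∷ 72 ∷ []) ∷ (29 ∷ 48 ∷ 52 ∷ 73 ∷ [])
    ∷ (29 ∷ 56 ∷ 59 ∷ 67 ∷ []) ∷ (30 ∷ 34 ∷ 49 ∷ 55 ∷ []) ∷ (31 ∷ 37 ∷ 62 ∷ 71 ∷ []) ∷ (31 ∷ 38 ∷ 49 ∷ 61 ∷ [])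
    ∷ (31 ∷ 46 ∷ 58 ∷ 69 ∷ []) ∷ (31 ∷ 47 ∷ 52 ∷ 59 ∷ []) ∷ (32 ∷ 41 ∷ 46 ∷ 57 ∷ []) ∷ (32 ∷ 42 ∷ 44 ∷ 61 ∷ [])
    ∷ (33 ∷ 42 ∷ 53 ∷ 59 ∷ []) ∷ (33 ∷ 51 ∷ 57 ∷ 70 ∷ []) ∷ (33 ∷ 55 ∷ 64 ∷ 71 ∷ []) ∷ (34 ∷ 41 ∷ 48 ∷ 65 ∷ [])
    ∷ (35 ∷ 39 ∷ 60 ∷ 64 ∷ []) ∷ (35 ∷ 41 ∷ 58 ∷ 72 ∷ []) ∷ (35 ∷ 51 ∷ 54 ∷ 63 ∷ []) ∷ (36 ∷ 44 ∷ 57 ∷ 59 ∷ [])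
    ∷ (37 ∷ 41 ∷ 50 ∷ 63 ∷ []) ∷ (37 ∷ 49 ∷ 68 ∷ 70 ∷ []) ∷ (38 ∷ 40 ∷ 57 ∷ 69 ∷ []) ∷ (38 ∷ 52 ∷ 65 ∷ 71 ∷ [])
    ∷ (39 ∷ 46 ∷ 61 ∷ 68 ∷ []) ∷ (39 ∷ 50 ∷ 58 ∷ 67 ∷ []) ∷ (40 ∷ 44 ∷ 51 ∷ 73 ∷ []) ∷ (40 ∷ 48 ∷ 67 ∷ 71 ∷ [])
    ∷ (42 ∷ 51 ∷ 55 ∷ 68 ∷ []) ∷ (43 ∷ 44 ∷ 63 ∷ 72 ∷ []) ∷ (43 ∷ 50 ∷ 59 ∷ 71 ∷ []) ∷ (45 ∷ 54 ∷ 65 ∷ 69 ∷ [])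
    ∷ (47 ∷ 51 ∷ 61 ∷ 67 ∷ [])
    ∷ []

lemma4p5 : GDD4 17 8 × GDD4 7 12
lemma4p5 = mkGDD4 17 8 blocks-2¹⁷5⁸ , mkGDD4 7 12 blocks-2⁷5¹²
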